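{- For any microCCS processes $P,Q$: $P\sim Q$ if and only if $P=Q$ is derivable in equational logic from the set of equations $\mathcal D$.
   Context: Fix an infinite set of names. MicroCCS processes: $\eta ::= a\mid\overline a$, $P::=\mathbf 0\mid \eta.P\mid P|Q$. Transitions: $\eta.P\xrightarrow{\eta}P$; if $P\xrightarrow{\eta}P'$, $Q\xrightarrow{\overline\eta}Q'$ then $P|Q\xrightarrow{\tau}P'|Q'$; if $P\xrightarrow{\mu}P'$ then $P|Q\xrightarrow{\mu}P'|Q$ and $Q|P\xrightarrow{\mu}Q|P'$. Strong bisimilarity $\sim$ is the union of all symmetric relations $\mathcal R$ such that $P\mathcal RQ$, $P\xrightarrow{\mu}P'$ imply $Q\xrightarrow{\mu}Q'$ with $P'\mathcal RQ'$. Write $P^k$ for the $k$-fold parallel composition of $P$. $\mathcal D$ consists of the equations $(C_1)\ X|Y=Y|X$, $(C_2)\ X|(Y|Z)=(X|Y)|Z$, $(C_3)\ X|\mathbf 0=X$, and for each $i\geq 1$ and each prefix $\eta$, $(D_i)\ \eta.(X|(\eta.X)^i)=(\eta.X)^{i+1}$ (with $X,Y,Z$ variables). Derivability is in equational logic. -}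

module Defs where

open import Data.Nat using (ℕ; zero; suc)
open import Data.Product using (Σ; _×_)
open import Level using (Level)

Name : Set
Name = ℕ

data Prefix : Set where
  inp : Name → Prefix
  out : Name → Prefix

co : Prefix → Prefix
co (inp a) = out a
co (out a) = inp a

data Act : Set where
  vis : Prefix → Act
  τ   : Act

infixr 6 _∙_
infixl 5 _∥_
data Proc : Set where
  𝟎   : Proc
  _∙_ : Prefix → Proc → Proc
  _∥_ : Proc → Proc → Proc

data _─[_]→_ : Proc → Act → Proc → Set where
  pre  : ∀ {η P} → (η ∙ P) ─[ vis η ]→ P
  com  : ∀ {P P' Q Q' η} → P ─[ vis η ]→ P' → Q ─[ vis (co η) ]→ Q' →
         (P ∥ Q) ─[ τ ]→ (P' ∥ Q')
  parL : ∀ {P P' Q μ} → P ─[ μ ]→ P' → (P ∥ Q) ─[ μ ]→ (P' ∥ Q)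
  parR : ∀ {P P' Q μ} → P ─[ μ ]→ P' → (Q ∥ P) ─[ μ ]→ (Q ∥ P')

Rel : Set₁
Rel = Proc → Proc → Set

SymmetricRel : Rel → Set
SymmetricRel R = ∀ {P Q} → R P Q → R Q P

IsSimulation : Rel → Set
IsSimulation R = ∀ {P Q μ P'} → R P Q → P ─[ μ ]→ P' →
                 Σ Proc (λ Q' → (Q ─[ μ ]→ Q') × R P' Q')

_∼_ : Proc → Proc → Set₁
P ∼ Q = Σ Rel (λ R → SymmetricRel R × IsSimulation R × R P Q)

data Term : Set where
  var : ℕ → Term
  nil : Term
  pfx : Prefix → Term → Term
  par : Term → Term → Term

⌜_⌝ : Proc → Term
⌜ 𝟎 ⌝     = nil
⌜ η ∙ P ⌝ = pfx η ⌜ P ⌝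
⌜ P ∥ Q ⌝ = par ⌜ P ⌝ ⌜ Q ⌝

_[_] : Term → (ℕ → Term) → Term
var x     [ σ ] = σ x
nil       [ σ ] = nil
pfx η t   [ σ ] = pfx η (t [ σ ])
par t u   [ σ ] = par (t [ σ ]) (u [ σ ])

pow : ℕ → Term → Term
pow zero          t = nil
pow (suc zero)    t = t
pow (suc (suc k)) t = par t (pow (suc k) t)

X Y Z : Term
X = var 0
Y = var 1
Z = var 2

data 𝒟 : Term → Term → Set where
  C1 : 𝒟 (par X Y) (par Y X)
  C2 : 𝒟 (par X (par Y Z)) (par (par X Y) Z)
  C3 : 𝒟 (par X nil) X
  -- (D_i) for i = suc j ≥ 1 and any prefix η
  Di : (j : ℕ) (η : Prefix) →
       𝒟 (pfx η (par X (pow (suc j) (pfx η X)))) (pow (suc (suc j)) (pfx η X))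

infix 4 𝒟⊢_≈_
data 𝒟⊢_≈_ : Term → Term → Set where
  ax    : ∀ {s t} → 𝒟 s t → 𝒟⊢ s ≈ t
  refl  : ∀ {t} → 𝒟⊢ t ≈ t
  sym   : ∀ {s t} → 𝒟⊢ s ≈ t → 𝒟⊢ t ≈ s
  trans : ∀ {s t u} → 𝒟⊢ s ≈ t → 𝒟⊢ t ≈ u → 𝒟⊢ s ≈ u
  subst : ∀ {s t} (σ : ℕ → Term) → 𝒟⊢ s ≈ t → 𝒟⊢ s [ σ ] ≈ t [ σ ]
  cpfx  : ∀ {s t} (η : Prefix) → 𝒟⊢ s ≈ t → 𝒟⊢ pfx η s ≈ pfx η t
  cpar  : ∀ {s s' t t'} → 𝒟⊢ s ≈ s' → 𝒟⊢ t ≈ t' → 𝒟⊢ par s t ≈ par s' t'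

-- Bisimilarity is the intersection of the stratified relations ∼[ n ], which
-- are congruences validating the axioms; in (Dᵢ) no two copies of η.X can synchronise,
-- as η is not its own complement. Since every transition decreases the size, ∼[ k ]
-- already coincides with all deeper approximants once k exceeds the sizes of both
-- processes, so the intersection is itself a bisimulation.
--
-- Every process is provably equal to a parallel product of canonical
-- prefixed processes η.∏C, where C is a sorted list of canonical ones and η.∏C is
-- not the left-hand side of an instance of (Dᵢ). Bisimilar canonical products N and M
-- are equal as multisets, by induction on size: firing n ∈ N is answered by firing some
-- m ∈ M with the same prefix, and by induction what remains agrees. For a heaviest n,
-- counting its copies forces m = n, and n can be cancelled, unless n does not occur in
-- M at all. In that case N = {n} and M consists of copies of m only, so n is
-- η.(X | (η.X)^k) with m = η.X: either n = m or n is reducible, both absurd.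

module Submission where

open import Defs
open import Function.Bundles using (_⇔_; mk⇔)

open import Data.Empty using (⊥-elim)
open import Data.Unit using (⊤; tt)
open import Data.Nat using (ℕ; zero; suc; _+_; _≤_; _<_; _⊔_; s≤s)
open import Data.Nat.Properties
  using ( ≤-refl; ≤-trans; ≤-pred; ≤-reflexive; <-≤-trans; <-irrefl; n≮n; n<1+n; m≤m+n; m≤n+m
        ; m≤n⇒m≤1+n; m≤m⊔n; m≤n⊔m; m≢1+n+m; +-suc; +-identityʳ; +-mono-<; +-monoˡ-<; +-monoʳ-<
        ; module ≤-Reasoning )
import Data.Nat.Properties as ℕ
open import Data.Nat.ListAction using (sum)
open import Data.Nat.ListAction.Properties using (sum-++; sum-↭)
open import Data.Product using (Σ; ∃-syntax; _×_; _,_; proj₁; proj₂)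
open import Data.Sum using (inj₁; inj₂)
open import Data.List using (List; []; _∷_; _++_; replicate; map; length; filter)
open import Data.List.Properties
  using ( ∷-injective; ++-assoc; ++-identityʳ; ≡-dec; map-++; length-++; length-replicate
        ; filter-++; filter-accept; filter-reject; filter-none; filter-some; filter-all )
open import Data.List.Extrema.Nat using (argmax; argmax-sel; f[⊥]≤f[argmax]; f[xs]≤f[argmax])
open import Data.List.Membership.Propositional using (_∈_; _∉_; find; lose)
open import Data.List.Membership.Propositional.Properties using (∈-++⁻; ∈-++⁺ʳ; ∈-∃++)
open import Data.List.Relation.Unary.Any using (Any; here; there; any?)
open import Data.List.Relation.Unary.All using (All; []; _∷_)
import Data.List.Relation.Unary.All as All
import Data.List.Relation.Unary.All.Properties as All
open import Data.List.Relation.Unary.All.Properties.Core using (¬Any⇒All¬)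
open import Data.List.Relation.Binary.Permutation.Propositional as ↭
  using (_↭_; ↭-sym; ↭-trans; ↭⇒↭ₛ′)
import Data.List.Relation.Binary.Permutation.Propositional.Properties as ↭
import Data.List.Relation.Binary.Lex.NonStrict as Lex
import Data.List.Relation.Binary.Pointwise as Pointwise
open import Data.List.Relation.Unary.Sorted.TotalOrder.Properties using (↗↭↗⇒≋)
open import Function using (_∘_; _$_; flip)
open import Relation.Binary.Bundles using (Setoid; DecTotalOrder)
open import Relation.Binary.Definitions using (DecidableEquality)
import Relation.Binary.Construct.On as On
open import Relation.Binary.PropositionalEquality as ≡ using (_≡_; _≢_; refl; cong; cong₂)
import Relation.Binary.Reasoning.Setoid as SetoidReasoning
open import Relation.Nullary using (Dec; ¬_; yes; no; contradiction)
open import Relation.Nullary.Decidable using (map′; _×-dec_)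

co-involutive : ∀ η → co (co η) ≡ η
co-involutive (inp a) = refl
co-involutive (out a) = refl

vis-injective : ∀ {η θ} → vis η ≡ vis θ → η ≡ θ
vis-injective refl = refl

co-irreflexive : ∀ η → co η ≢ η
co-irreflexive (inp a) ()
co-irreflexive (out a) ()

-- Stratified bisimilarity

size : Proc → ℕ
size 𝟎       = 0
size (η ∙ P) = suc (size P)
size (P ∥ Q) = size P + size Q

size-decreasing : ∀ {P μ P'} → P ─[ μ ]→ P' → size P' < size P
size-decreasing pre              = n<1+n _
size-decreasing (com p q)        = +-mono-< (size-decreasing p) (size-decreasing q)
size-decreasing {_ ∥ Q} (parL p) = +-monoˡ-< (size Q) (size-decreasing p)
size-decreasing {Q ∥ _} (parR p) = +-monoʳ-< (size Q) (size-decreasing p)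

size-after : ∀ {P μ P' k} → P ─[ μ ]→ P' → size P ≤ suc k → size P' ≤ k
size-after t P≤ = ≤-pred (<-≤-trans (size-decreasing t) P≤)

size-0-inert : ∀ {P μ P'} → size P ≤ 0 → ¬ (P ─[ μ ]→ P')
size-0-inert P≤0 t with () ← ≤-trans (size-decreasing t) P≤0

Transfer : (Proc → Proc → Set) → Proc → Proc → Set
Transfer R P Q = ∀ {μ P'} → P ─[ μ ]→ P' → Σ Proc λ Q' → Q ─[ μ ]→ Q' × R P' Q'

transfer-map : ∀ {R S P Q} → (∀ {P' Q'} → R P' Q' → S P' Q') → Transfer R P Q → Transfer S P Q
transfer-map f tr t = let Q' , t' , r = tr t in Q' , t' , f r

transfer-∘ : ∀ {R S T P Q U} → (∀ {P' Q' U'} → R P' Q' → S Q' U' → T P' U') →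
             Transfer R P Q → Transfer S Q U → Transfer T P U
transfer-∘ f tr tr' t = let Q' , t' , r = tr t ; U' , t'' , s = tr' t' in U' , t'' , f r s

infix 4 _∼[_]_ _≃_

_∼[_]_ : Proc → ℕ → Proc → Set
P ∼[ zero  ] Q = ⊤
P ∼[ suc n ] Q = Transfer _∼[ n ]_ P Q × Transfer (flip _∼[ n ]_) Q P

∼[]-refl : ∀ n {P} → P ∼[ n ] P
∼[]-refl zero    = tt
∼[]-refl (suc n) = (λ t → _ , t , ∼[]-refl n) , (λ t → _ , t , ∼[]-refl n)

∼[]-sym : ∀ n {P Q} → P ∼[ n ] Q → Q ∼[ n ] P
∼[]-sym zero    _       = tt
∼[]-sym (suc n) (f , g) = transfer-map (∼[]-sym n) g , transfer-map (∼[]-sym n) f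

∼[]-trans : ∀ n {P Q R} → P ∼[ n ] Q → Q ∼[ n ] R → P ∼[ n ] R
∼[]-trans zero    _       _         = tt
∼[]-trans (suc n) (f , g) (f' , g') =
  transfer-∘ (∼[]-trans n) f f' , transfer-∘ (flip (∼[]-trans n)) g' g

∼[]-pred : ∀ n {P Q} → P ∼[ suc n ] Q → P ∼[ n ] Q
∼[]-pred zero    _       = tt
∼[]-pred (suc n) (f , g) = transfer-map (∼[]-pred n) f , transfer-map (∼[]-pred n) g

∼[]-∙ : ∀ n η {P Q} → P ∼[ n ] Q → η ∙ P ∼[ suc n ] η ∙ Q
∼[]-∙ n η P∼Q = (λ { pre → _ , pre , P∼Q }) , (λ { pre → _ , pre , P∼Q })

∼[]-intro : ∀ n {P Q} → Transfer _∼[ n ]_ P Q → Transfer _∼[ n ]_ Q P → P ∼[ suc n ] Q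
∼[]-intro n forth back = forth , transfer-map (∼[]-sym n) back

∼[]-∥ : ∀ n {P Q R S} → P ∼[ n ] Q → R ∼[ n ] S → P ∥ R ∼[ n ] Q ∥ S

∥-forth : ∀ n {P Q R S} → P ∼[ suc n ] Q → R ∼[ suc n ] S → Transfer _∼[ n ]_ (P ∥ R) (Q ∥ S)
∥-forth n (f , _) R∼S (parL t) = let Q' , u , r = f t in Q' ∥ _ , parL u , ∼[]-∥ n r (∼[]-pred n R∼S)
∥-forth n P∼Q (f , _) (parR t) = let S' , u , r = f t in _ ∥ S' , parR u , ∼[]-∥ n (∼[]-pred n P∼Q) r
∥-forth n (f , _) (f' , _) (com t t') =
  let Q' , u , r = f t ; S' , u' , r' = f' t' in Q' ∥ S' , com u u' , ∼[]-∥ n r r'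

∼[]-∥ zero    _   _   = tt
∼[]-∥ (suc n) P∼Q R∼S =
  ∼[]-intro n (∥-forth n P∼Q R∼S) (∥-forth n (∼[]-sym (suc n) P∼Q) (∼[]-sym (suc n) R∼S))

∼[]-∥-comm : ∀ n P Q → P ∥ Q ∼[ n ] Q ∥ P

∥-comm-forth : ∀ n P Q → Transfer _∼[ n ]_ (P ∥ Q) (Q ∥ P)
∥-comm-forth n P Q (parL {P' = P'} t) = Q ∥ P' , parR t , ∼[]-∥-comm n P' Q
∥-comm-forth n P Q (parR {P' = Q'} t) = Q' ∥ P , parL t , ∼[]-∥-comm n P Q'
∥-comm-forth n P Q (com {P' = P'} {Q' = Q'} {η = η} t u) =
  Q' ∥ P' , com u (≡.subst (λ θ → P ─[ vis θ ]→ P') (≡.sym (co-involutive η)) t) ,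
  ∼[]-∥-comm n P' Q'

∼[]-∥-comm zero    P Q = tt
∼[]-∥-comm (suc n) P Q = ∼[]-intro n (∥-comm-forth n P Q) (∥-comm-forth n Q P)

∼[]-∥-assoc : ∀ n P Q R → P ∥ (Q ∥ R) ∼[ n ] (P ∥ Q) ∥ R
∼[]-∥-assoc zero    P Q R = tt
∼[]-∥-assoc (suc n) P Q R = ∼[]-intro n forth back
  where
  forth : Transfer _∼[ n ]_ (P ∥ (Q ∥ R)) ((P ∥ Q) ∥ R)
  forth (parL t)          = _ , parL (parL t)  , ∼[]-∥-assoc n _ Q R
  forth (parR (parL t))   = _ , parL (parR t)  , ∼[]-∥-assoc n P _ R
  forth (parR (parR t))   = _ , parR t         , ∼[]-∥-assoc n P Q _
  forth (parR (com t u))  = _ , com (parR t) u , ∼[]-∥-assoc n P _ _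
  forth (com t (parL u))  = _ , parL (com t u) , ∼[]-∥-assoc n _ _ R
  forth (com t (parR u))  = _ , com (parL t) u , ∼[]-∥-assoc n _ Q _
  back : Transfer _∼[ n ]_ ((P ∥ Q) ∥ R) (P ∥ (Q ∥ R))
  back (parL (parL t))    = _ , parL t         , ∼[]-sym n (∼[]-∥-assoc n _ Q R)
  back (parL (parR t))    = _ , parR (parL t)  , ∼[]-sym n (∼[]-∥-assoc n P _ R)
  back (parR t)           = _ , parR (parR t)  , ∼[]-sym n (∼[]-∥-assoc n P Q _)
  back (parL (com t u))   = _ , com t (parL u) , ∼[]-sym n (∼[]-∥-assoc n _ _ R)
  back (com (parL t) u)   = _ , com t (parR u) , ∼[]-sym n (∼[]-∥-assoc n _ Q _)
  back (com (parR t) u)   = _ , parR (com t u) , ∼[]-sym n (∼[]-∥-assoc n P _ _)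

∼[]-∥-identityʳ : ∀ n P → P ∥ 𝟎 ∼[ n ] P
∼[]-∥-identityʳ zero    P = tt
∼[]-∥-identityʳ (suc n) P = ∼[]-intro n forth back
  where
  forth : Transfer _∼[ n ]_ (P ∥ 𝟎) P
  forth (parL t) = _ , t , ∼[]-∥-identityʳ n _
  back : Transfer _∼[ n ]_ P (P ∥ 𝟎)
  back t = _ , parL t , ∼[]-sym n (∼[]-∥-identityʳ n _)

∼[]-stabilises : ∀ k m {P Q} → size P ≤ k → size Q ≤ k → P ∼[ k ] Q → P ∼[ m ] Q
∼[]-stabilises _       zero    _  _  _       = tt
∼[]-stabilises zero    (suc m) P≤ Q≤ _       =
  (λ t → ⊥-elim (size-0-inert P≤ t)) , (λ t → ⊥-elim (size-0-inert Q≤ t))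
∼[]-stabilises (suc k) (suc m) P≤ Q≤ (f , g) =
  (λ t → let Q' , t' , r = f t in Q' , t' , ∼[]-stabilises k m (size-after t P≤) (size-after t' Q≤) r) ,
  (λ t → let P' , t' , r = g t in P' , t' , ∼[]-stabilises k m (size-after t' P≤) (size-after t Q≤) r)

_≃_ : Proc → Proc → Set
P ≃ Q = ∀ n → P ∼[ n ] Q

≃-refl : ∀ {P} → P ≃ P
≃-refl n = ∼[]-refl n

≃-sym : ∀ {P Q} → P ≃ Q → Q ≃ P
≃-sym P≃Q n = ∼[]-sym n (P≃Q n)

≃-trans : ∀ {P Q R} → P ≃ Q → Q ≃ R → P ≃ R
≃-trans P≃Q Q≃R n = ∼[]-trans n (P≃Q n) (Q≃R n)

≃-∙ : ∀ η {P Q} → P ≃ Q → η ∙ P ≃ η ∙ Q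
≃-∙ η P≃Q zero    = tt
≃-∙ η P≃Q (suc n) = ∼[]-∙ n η (P≃Q n)

≃-∥ : ∀ {P Q R S} → P ≃ Q → R ≃ S → P ∥ R ≃ Q ∥ S
≃-∥ P≃Q R≃S n = ∼[]-∥ n (P≃Q n) (R≃S n)

≃-∥-comm : ∀ P Q → P ∥ Q ≃ Q ∥ P
≃-∥-comm P Q n = ∼[]-∥-comm n P Q

≃-∥-assoc : ∀ P Q R → P ∥ (Q ∥ R) ≃ (P ∥ Q) ∥ R
≃-∥-assoc P Q R n = ∼[]-∥-assoc n P Q R

≃-∥-identityʳ : ∀ P → P ∥ 𝟎 ≃ P
≃-∥-identityʳ P n = ∼[]-∥-identityʳ n P

-- Approximants beyond the sizes of both processes are all equal, so one level
-- suffices to choose the matching transition.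
≃-transfer : ∀ {P Q} → P ≃ Q → Transfer _≃_ P Q
≃-transfer {P} {Q} P≃Q t =
  let k = size P ⊔ size Q ; Q' , t' , r = proj₁ (P≃Q (suc k)) t in
  Q' , t' , λ m → ∼[]-stabilises k m (size-after t (m≤n⇒m≤1+n (m≤m⊔n _ _)))
                                     (size-after t' (m≤n⇒m≤1+n (m≤n⊔m _ _))) r

≃-intro : ∀ {P Q} → Transfer _≃_ P Q → Transfer _≃_ Q P → P ≃ Q
≃-intro forth back zero    = tt
≃-intro forth back (suc n) = ∼[]-intro n (transfer-map (_$ n) forth) (transfer-map (_$ n) back)

∼⇒≃ : ∀ {P Q} → P ∼ Q → P ≃ Q
∼⇒≃ (R , R-sym , R-sim , PRQ) n = approximate n PRQ
  where
  approximate : ∀ n {P Q} → R P Q → P ∼[ n ] Q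
  approximate zero    _   = tt
  approximate (suc n) PRQ =
    ∼[]-intro n (transfer-map (approximate n) (R-sim PRQ))
                (transfer-map (approximate n) (R-sim (R-sym PRQ)))

≃⇒∼ : ∀ {P Q} → P ≃ Q → P ∼ Q
≃⇒∼ P≃Q = _≃_ , ≃-sym , (λ r → ≃-transfer r) , P≃Q

≃-setoid : Setoid _ _
≃-setoid = record
  { Carrier = Proc ; _≈_ = _≃_
  ; isEquivalence = record { refl = ≃-refl ; sym = ≃-sym ; trans = ≃-trans } }

module ≃-Reasoning = SetoidReasoning ≃-setoid

-- Soundness

𝒟-setoid : Setoid _ _
𝒟-setoid = record
  { Carrier = Term ; _≈_ = 𝒟⊢_≈_
  ; isEquivalence = record { refl = refl ; sym = sym ; trans = trans } }

module 𝒟-Reasoning = SetoidReasoning 𝒟-setoid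

infix 10 ⟦_⟧_

⟦_⟧_ : Term → (ℕ → Proc) → Proc
⟦ var x   ⟧ ρ = ρ x
⟦ nil     ⟧ ρ = 𝟎
⟦ pfx η t ⟧ ρ = η ∙ ⟦ t ⟧ ρ
⟦ par t u ⟧ ρ = ⟦ t ⟧ ρ ∥ ⟦ u ⟧ ρ

⟦⟧-[] : ∀ t σ ρ → ⟦ t [ σ ] ⟧ ρ ≡ ⟦ t ⟧ (λ x → ⟦ σ x ⟧ ρ)
⟦⟧-[] (var x)   σ ρ = refl
⟦⟧-[] nil       σ ρ = refl
⟦⟧-[] (pfx η t) σ ρ = cong (η ∙_) (⟦⟧-[] t σ ρ)
⟦⟧-[] (par t u) σ ρ = cong₂ _∥_ (⟦⟧-[] t σ ρ) (⟦⟧-[] u σ ρ)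

⟦⌜⌝⟧ : ∀ P ρ → ⟦ ⌜ P ⌝ ⟧ ρ ≡ P
⟦⌜⌝⟧ 𝟎       ρ = refl
⟦⌜⌝⟧ (η ∙ P) ρ = cong (η ∙_) (⟦⌜⌝⟧ P ρ)
⟦⌜⌝⟧ (P ∥ Q) ρ = cong₂ _∥_ (⟦⌜⌝⟧ P ρ) (⟦⌜⌝⟧ Q ρ)

powₚ : ℕ → Proc → Proc
powₚ zero          P = 𝟎
powₚ (suc zero)    P = P
powₚ (suc (suc k)) P = P ∥ powₚ (suc k) P

⟦pow⟧ : ∀ k t ρ → ⟦ pow k t ⟧ ρ ≡ powₚ k (⟦ t ⟧ ρ)
⟦pow⟧ zero          t ρ = refl
⟦pow⟧ (suc zero)    t ρ = refl
⟦pow⟧ (suc (suc k)) t ρ = cong (⟦ t ⟧ ρ ∥_) (⟦pow⟧ (suc k) t ρ)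

≃-powₚ-suc : ∀ k P → P ∥ powₚ k P ≃ powₚ (suc k) P
≃-powₚ-suc zero    P = ≃-∥-identityʳ P
≃-powₚ-suc (suc k) P = ≃-refl

≃-∥-swapˡ : ∀ P Q R → P ∥ (Q ∥ R) ≃ Q ∥ (P ∥ R)
≃-∥-swapˡ P Q R = begin
  P ∥ (Q ∥ R)  ≈⟨ ≃-∥-assoc P Q R ⟩
  (P ∥ Q) ∥ R  ≈⟨ ≃-∥ (≃-∥-comm P Q) ≃-refl ⟩
  (Q ∥ P) ∥ R  ≈⟨ ≃-∥-assoc Q P R ⟨
  Q ∥ (P ∥ R)  ∎
  where open ≃-Reasoning

powₚ-transition : ∀ r A η {μ Q} → powₚ (suc r) (η ∙ A) ─[ μ ]→ Q →
                  μ ≡ vis η × Q ≃ A ∥ powₚ r (η ∙ A)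
powₚ-transition zero    A η pre        = refl , ≃-sym (≃-∥-identityʳ A)
powₚ-transition (suc r) A η (parL pre) = refl , ≃-refl
powₚ-transition (suc r) A η (parR {P' = Q} t) with powₚ-transition r A η t
... | μ≡η , Q≃ = μ≡η , (begin
  η ∙ A ∥ Q                    ≈⟨ ≃-∥ ≃-refl Q≃ ⟩
  η ∙ A ∥ (A ∥ powₚ r (η ∙ A)) ≈⟨ ≃-∥-swapˡ (η ∙ A) A _ ⟩
  A ∥ (η ∙ A ∥ powₚ r (η ∙ A)) ≈⟨ ≃-∥ ≃-refl (≃-powₚ-suc r (η ∙ A)) ⟩
  A ∥ powₚ (suc r) (η ∙ A)     ∎)
  where open ≃-Reasoning
powₚ-transition (suc r) A η (com pre t) with powₚ-transition r A η t
... | co-η≡η , _ = ⊥-elim (co-irreflexive η (vis-injective co-η≡η))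

D-sound : ∀ j η A → η ∙ (A ∥ powₚ (suc j) (η ∙ A)) ≃ powₚ (suc (suc j)) (η ∙ A)
D-sound j η A = ≃-intro (λ { pre → _ , parL pre , ≃-refl }) back
  where
  back : Transfer _≃_ (powₚ (suc (suc j)) (η ∙ A)) (η ∙ (A ∥ powₚ (suc j) (η ∙ A)))
  back t with powₚ-transition (suc j) A η t
  ... | refl , Q≃ = _ , pre , Q≃

axiom-sound : ∀ {s t} → 𝒟 s t → ∀ ρ → ⟦ s ⟧ ρ ≃ ⟦ t ⟧ ρ
axiom-sound C1       ρ = ≃-∥-comm _ _
axiom-sound C2       ρ = ≃-∥-assoc _ _ _
axiom-sound C3       ρ = ≃-∥-identityʳ _
axiom-sound (Di j η) ρ rewrite ⟦pow⟧ (suc j) (pfx η X) ρ = D-sound j η (ρ 0)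

sound : ∀ {s t} → 𝒟⊢ s ≈ t → ∀ ρ → ⟦ s ⟧ ρ ≃ ⟦ t ⟧ ρ
sound (ax a)      ρ = axiom-sound a ρ
sound refl        ρ = ≃-refl
sound (sym d)     ρ = ≃-sym (sound d ρ)
sound (trans d e) ρ = ≃-trans (sound d ρ) (sound e ρ)
sound (subst {s} {t} σ d) ρ rewrite ⟦⟧-[] s σ ρ | ⟦⟧-[] t σ ρ = sound d (λ x → ⟦ σ x ⟧ ρ)
sound (cpfx η d)  ρ = ≃-∙ η (sound d ρ)
sound (cpar d e)  ρ = ≃-∥ (sound d ρ) (sound e ρ)

sound-closed : ∀ {P Q} → 𝒟⊢ ⌜ P ⌝ ≈ ⌜ Q ⌝ → P ≃ Q
sound-closed {P} {Q} d = ≡.subst₂ _≃_ (⟦⌜⌝⟧ P _) (⟦⌜⌝⟧ Q _) (sound d (λ _ → 𝟎))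

assign : Term → Term → Term → ℕ → Term
assign s t u 0 = s
assign s t u 1 = t
assign s t u 2 = u
assign s t u _ = nil

⊢-comm : ∀ s t → 𝒟⊢ par s t ≈ par t s
⊢-comm s t = subst (assign s t nil) (ax C1)

⊢-assoc : ∀ s t u → 𝒟⊢ par s (par t u) ≈ par (par s t) u
⊢-assoc s t u = subst (assign s t u) (ax C2)

⊢-identityʳ : ∀ s → 𝒟⊢ par s nil ≈ s
⊢-identityʳ s = subst (assign s nil nil) (ax C3)

⊢-swapˡ : ∀ s t u → 𝒟⊢ par s (par t u) ≈ par t (par s u)
⊢-swapˡ s t u = begin
  par s (par t u)  ≈⟨ ⊢-assoc s t u ⟩
  par (par s t) u  ≈⟨ cpar (⊢-comm s t) refl ⟩
  par (par t s) u  ≈⟨ ⊢-assoc t s u ⟨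
  par t (par s u)  ∎
  where open 𝒟-Reasoning

pow-[] : ∀ k t σ → pow k t [ σ ] ≡ pow k (t [ σ ])
pow-[] zero          t σ = refl
pow-[] (suc zero)    t σ = refl
pow-[] (suc (suc k)) t σ = cong (par (t [ σ ])) (pow-[] (suc k) t σ)

⊢-D : ∀ j η s → 𝒟⊢ pfx η (par s (pow (suc j) (pfx η s))) ≈ pow (suc (suc j)) (pfx η s)
⊢-D j η s = ≡.subst₂ 𝒟⊢_≈_ (cong (pfx η ∘ par s) (pow-[] (suc j) (pfx η X) σ))
                            (pow-[] (suc (suc j)) (pfx η X) σ)
                            (subst σ (ax (Di j η)))
  where
  σ = assign s nil nil

-- (η , P) stands for η ∙ P, and a list of them for the multiset of parallel components of ∏.
Elem : Set
Elem = Prefix × Proc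

prefixed : Elem → Proc
prefixed (η , P) = η ∙ P

∏ : List Elem → Proc
∏ []       = 𝟎
∏ (e ∷ es) = prefixed e ∥ ∏ es

flat : Proc → List Elem
flat 𝟎       = []
flat (η ∙ P) = (η , P) ∷ []
flat (P ∥ Q) = flat P ++ flat Q

flat-∏ : ∀ es → flat (∏ es) ≡ es
flat-∏ []             = refl
flat-∏ ((η , P) ∷ es) = cong ((η , P) ∷_) (flat-∏ es)

residual : Elem → List Elem
residual (η , P) = flat P

⊢-∏-++ : ∀ es fs → 𝒟⊢ ⌜ ∏ (es ++ fs) ⌝ ≈ par ⌜ ∏ es ⌝ ⌜ ∏ fs ⌝
⊢-∏-++ []       fs = sym (trans (⊢-comm nil _) (⊢-identityʳ _))
⊢-∏-++ (e ∷ es) fs = trans (cpar refl (⊢-∏-++ es fs)) (⊢-assoc _ _ _)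

⊢-flat : ∀ P → 𝒟⊢ ⌜ P ⌝ ≈ ⌜ ∏ (flat P) ⌝
⊢-flat 𝟎       = refl
⊢-flat (η ∙ P) = sym (⊢-identityʳ _)
⊢-flat (P ∥ Q) = trans (cpar (⊢-flat P) (⊢-flat Q)) (sym (⊢-∏-++ (flat P) (flat Q)))

⊢-replicate : ∀ k e → 𝒟⊢ ⌜ ∏ (replicate k e) ⌝ ≈ pow k ⌜ prefixed e ⌝
⊢-replicate zero          e = refl
⊢-replicate (suc zero)    e = ⊢-identityʳ _
⊢-replicate (suc (suc k)) e = cpar refl (⊢-replicate (suc k) e)

⊢-↭ : ∀ {es fs} → es ↭ fs → 𝒟⊢ ⌜ ∏ es ⌝ ≈ ⌜ ∏ fs ⌝
⊢-↭ ↭.refl         = refl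
⊢-↭ (↭.prep e p)   = cpar refl (⊢-↭ p)
⊢-↭ (↭.swap e f p) = trans (⊢-swapˡ _ _ _) (cpar refl (cpar refl (⊢-↭ p)))
⊢-↭ (↭.trans p q)  = trans (⊢-↭ p) (⊢-↭ q)

∏-↭ : ∀ {es fs} → es ↭ fs → ∏ es ≃ ∏ fs
∏-↭ p = sound-closed (⊢-↭ p)

∏-flat-++ : ∀ P es → P ∥ ∏ es ≃ ∏ (flat P ++ es)
∏-flat-++ P es = sound-closed (trans (cpar (⊢-flat P) refl) (sym (⊢-∏-++ (flat P) es)))

data Fires {A : Set} (_≈_ : A → List Elem → Set) (M : List Elem) (η : Prefix) (a : A) : Set where
  fires : ∀ m R → M ↭ m ∷ R → proj₁ m ≡ η → a ≈ (residual m ++ R) → Fires _≈_ M η a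

∏-visible : ∀ M {η Q} → ∏ M ─[ vis η ]→ Q → Fires (λ Q L → Q ≃ ∏ L) M η Q
∏-visible (e ∷ M) (parL pre) = fires e M ↭.refl refl (∏-flat-++ _ M)
∏-visible (e ∷ M) (parR t) with ∏-visible M t
... | fires m R M↭ m-η Q≃ =
  fires m (e ∷ R) (↭-trans (↭.prep e M↭) (↭.swap e m ↭.refl)) m-η
        (≃-trans (≃-∥ ≃-refl Q≃) (∏-↭ (↭-sym (↭.shift e (residual m) R))))

∏-match : ∀ {N M n R} → ∏ N ≃ ∏ M → N ↭ n ∷ R →
          Fires (λ L L' → ∏ L ≃ ∏ L') M (proj₁ n) (residual n ++ R)
∏-match {n = η , P} {R} N≃M N↭
  with ≃-transfer (≃-trans (∏-↭ (↭-sym N↭)) N≃M) (parL {Q = ∏ R} (pre {η} {P}))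
... | Q , t , PR≃Q with ∏-visible _ t
... | fires m R' M↭ m-η Q≃ = fires m R' M↭ m-η (≃-trans (≃-sym (∏-flat-++ P R)) (≃-trans PR≃Q Q≃))

encode : Proc → List ℕ
encode 𝟎           = 0 ∷ []
encode (inp a ∙ P) = 1 ∷ a ∷ encode P
encode (out a ∙ P) = 2 ∷ a ∷ encode P
encode (P ∥ Q)     = 3 ∷ encode P ++ encode Q

-- Stated for arbitrary continuations, so that the induction passes through the ∥ case.
encode-injective : ∀ P Q {xs ys} → encode P ++ xs ≡ encode Q ++ ys → P ≡ Q × xs ≡ ys
encode-injective 𝟎           𝟎           e = refl , proj₂ (∷-injective e)
encode-injective (inp a ∙ P) (inp b ∙ Q) e
  with refl , e′ ← ∷-injective (proj₂ (∷-injective e))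
  with refl , refl ← encode-injective P Q e′ = refl , refl
encode-injective (out a ∙ P) (out b ∙ Q) e
  with refl , e′ ← ∷-injective (proj₂ (∷-injective e))
  with refl , refl ← encode-injective P Q e′ = refl , refl
encode-injective (P ∥ P′) (Q ∥ Q′) {xs} {ys} e
  with refl , e′ ← encode-injective P Q (≡.trans (≡.sym (++-assoc (encode P) _ xs))
                                         (≡.trans (proj₂ (∷-injective e)) (++-assoc (encode Q) _ ys)))
  with refl , refl ← encode-injective P′ Q′ e′ = refl , refl
encode-injective 𝟎           (inp _ ∙ _) ()
encode-injective 𝟎           (out _ ∙ _) ()
encode-injective 𝟎           (_ ∥ _)     ()
encode-injective (inp _ ∙ _) 𝟎           ()
encode-injective (inp _ ∙ _) (out _ ∙ _) ()
encode-injective (inp _ ∙ _) (_ ∥ _)     ()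
encode-injective (out _ ∙ _) 𝟎           ()
encode-injective (out _ ∙ _) (inp _ ∙ _) ()
encode-injective (out _ ∙ _) (_ ∥ _)     ()
encode-injective (_ ∥ _)     𝟎           ()
encode-injective (_ ∥ _)     (inp _ ∙ _) ()
encode-injective (_ ∥ _)     (out _ ∙ _) ()

encodeₑ : Elem → List ℕ
encodeₑ (η , P) = encode (η ∙ P)

encodeₑ-injective : ∀ {e f} → encodeₑ e ≡ encodeₑ f → e ≡ f
encodeₑ-injective {η , P} {θ , Q} e
  with refl , _ ← encode-injective (η ∙ P) (θ ∙ Q) (≡.subst₂ _≡_ (≡.sym (++-identityʳ _)) (≡.sym (++-identityʳ _)) e)
  = refl

_≟ₑ_ : DecidableEquality Elem
e ≟ₑ f = map′ encodeₑ-injective (cong encodeₑ) (≡-dec ℕ._≟_ (encodeₑ e) (encodeₑ f))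

Elem-order : DecTotalOrder _ _ _
Elem-order = On.decTotalOrder (Lex.≤-decTotalOrder ℕ.≤-decTotalOrder) encodeₑ

open DecTotalOrder Elem-order using (totalOrder)
open import Data.List.Sort Elem-order using (sort; sort-↭; sort-↗)
open import Data.List.Relation.Unary.Sorted.TotalOrder totalOrder using (Sorted)
open import Data.List.Membership.DecPropositional _≟ₑ_ using (_∈?_)

sorted-unique : ∀ {xs ys} → Sorted xs → Sorted ys → xs ↭ ys → xs ≡ ys
sorted-unique xs↗ ys↗ xs↭ys =
  Pointwise.Pointwise-≡⇒≡ (Pointwise.map (encodeₑ-injective ∘ Pointwise.Pointwise-≡⇒≡)
    (↗↭↗⇒≋ totalOrder xs↗ ys↗ (↭⇒↭ₛ′ (DecTotalOrder.Eq.isEquivalence Elem-order) xs↭ys)))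

weight : Elem → ℕ
weight (η , P) = suc (size P)

‖_‖ : List Elem → ℕ
‖ es ‖ = sum (map weight es)

‖‖-++ : ∀ es fs → ‖ es ++ fs ‖ ≡ ‖ es ‖ + ‖ fs ‖
‖‖-++ es fs = ≡.trans (cong sum (map-++ weight es fs)) (sum-++ (map weight es) _)

‖‖-↭ : ∀ {es fs} → es ↭ fs → ‖ es ‖ ≡ ‖ fs ‖
‖‖-↭ p = sum-↭ (↭.map⁺ weight p)

‖flat‖ : ∀ P → ‖ flat P ‖ ≡ size P
‖flat‖ 𝟎       = refl
‖flat‖ (η ∙ P) = +-identityʳ _
‖flat‖ (P ∥ Q) = ≡.trans (‖‖-++ (flat P) (flat Q)) (cong₂ _+_ (‖flat‖ P) (‖flat‖ Q))

‖‖-fire : ∀ {N e R} → N ↭ e ∷ R → ‖ N ‖ ≡ suc ‖ residual e ++ R ‖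
‖‖-fire {N} {η , P} {R} N↭ = begin
  ‖ N ‖                           ≡⟨ ‖‖-↭ N↭ ⟩
  suc (size P) + ‖ R ‖            ≡⟨ cong (λ s → suc s + ‖ R ‖) (‖flat‖ P) ⟨
  suc (‖ flat P ‖ + ‖ R ‖)        ≡⟨ cong suc (‖‖-++ (flat P) R) ⟨
  suc ‖ flat P ++ R ‖             ∎
  where open ≡.≡-Reasoning

flat-lighter : ∀ {x} P → x ∈ flat P → weight x ≤ size P
flat-lighter (η ∙ P) (here refl) = ≤-refl
flat-lighter (P ∥ Q) x∈ with ∈-++⁻ (flat P) x∈
... | inj₁ x∈P = ≤-trans (flat-lighter P x∈P) (m≤m+n (size P) (size Q))
... | inj₂ x∈Q = ≤-trans (flat-lighter Q x∈Q) (m≤n+m (size Q) (size P))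

residual-lighter : ∀ {x} e → x ∈ residual e → weight x < weight e
residual-lighter (η , P) x∈ = s≤s (flat-lighter P x∈)

∉-residual : ∀ {x e} → weight e ≤ weight x → x ∉ residual e
∉-residual {x} {e} e≤x x∈ = n≮n (weight x) (<-≤-trans (residual-lighter e x∈) e≤x)

occ : Elem → List Elem → ℕ
occ x es = length (filter (x ≟ₑ_) es)

occ-↭ : ∀ x {es fs} → es ↭ fs → occ x es ≡ occ x fs
occ-↭ x p = ↭.↭-length (↭.filter-↭ (x ≟ₑ_) p)

occ-++ : ∀ x es fs → occ x (es ++ fs) ≡ occ x es + occ x fs
occ-++ x es fs = ≡.trans (cong length (filter-++ (x ≟ₑ_) es fs)) (length-++ (filter (x ≟ₑ_) es))

occ-here : ∀ x es → occ x (x ∷ es) ≡ suc (occ x es)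
occ-here x es = cong length (filter-accept (x ≟ₑ_) refl)

occ-there : ∀ {x y} es → x ≢ y → occ x (y ∷ es) ≡ occ x es
occ-there es x≢y = cong length (filter-reject (_ ≟ₑ_) x≢y)

occ-∷-≤ : ∀ x y es → occ x (y ∷ es) ≤ suc (occ x es)
occ-∷-≤ x y es with x ≟ₑ y
... | yes refl = ≤-reflexive (occ-here x es)
... | no  x≢y  = m≤n⇒m≤1+n (≤-reflexive (occ-there es x≢y))

occ-∉ : ∀ {x es} → x ∉ es → occ x es ≡ 0
occ-∉ {x} {es} x∉ = cong length (filter-none (x ≟ₑ_) (¬Any⇒All¬ es x∉))

occ-∈ : ∀ {x es} → x ∈ es → ∃[ k ] occ x es ≡ suc k
occ-∈ {x} {es} x∈ with occ x es | filter-some (x ≟ₑ_) x∈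
... | suc k | _ = k , refl

occ-replicate : ∀ x k → occ x (replicate k x) ≡ k
occ-replicate x k = ≡.trans (cong length (filter-all (x ≟ₑ_) (All.replicate⁺ k refl))) (length-replicate k)

occ-residual-++ : ∀ {x e} es → weight e ≤ weight x → occ x (residual e ++ es) ≡ occ x es
occ-residual-++ {x} {e} es e≤x =
  ≡.trans (occ-++ x (residual e) es) (cong (_+ occ x es) (occ-∉ (∉-residual {x} {e} e≤x)))

-- Canonical forms

-- η ∙ ∏ C is, up to commutativity and associativity, the left-hand side of an instance of (D_{k+1}).
Reducible : Prefix → List Elem → Set
Reducible η C = Σ Elem λ m → Σ ℕ λ k → proj₁ m ≡ η × C ↭ residual m ++ replicate (suc k) m

data Canonical : Elem → Set where
  canonical : ∀ {η C} → Sorted C → All Canonical C → ¬ Reducible η C → Canonical (η , ∏ C)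

Canonical-residual : ∀ {e} → Canonical e → All Canonical (residual e)
Canonical-residual (canonical {C = C} _ cC _) rewrite flat-∏ C = cC

Canonical-irreducible : ∀ {e} → Canonical e → ¬ Reducible (proj₁ e) (residual e)
Canonical-irreducible (canonical {C = C} _ _ irr) rewrite flat-∏ C = irr

Canonical-injective : ∀ {e f} → Canonical e → Canonical f →
                      proj₁ e ≡ proj₁ f → residual e ↭ residual f → e ≡ f
Canonical-injective (canonical {C = C} C↗ _ _) (canonical {C = D} D↗ _ _) refl C↭D
  rewrite flat-∏ C | flat-∏ D | sorted-unique C↗ D↗ C↭D = refl

_≟ₚ_ : DecidableEquality Prefix
η ≟ₚ θ = map′ (cong proj₁) (cong (_, 𝟎)) ((η , 𝟎) ≟ₑ (θ , 𝟎))

_↭?_ : (es fs : List Elem) → Dec (es ↭ fs)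
es ↭? fs = map′ from to (≡-dec _≟ₑ_ (sort es) (sort fs))
  where
  from : sort es ≡ sort fs → es ↭ fs
  from e = ↭-trans (↭-sym (sort-↭ es)) (≡.subst (_↭ fs) (≡.sym e) (sort-↭ fs))
  to : es ↭ fs → sort es ≡ sort fs
  to p = sorted-unique (sort-↗ es) (sort-↗ fs) (↭-trans (sort-↭ es) (↭-trans p (↭-sym (sort-↭ fs))))

-- A witness m of reducibility occurs in C, and then k is determined by its multiplicity.
reducible? : ∀ η C → Dec (Reducible η C)
reducible? η C = map′ from to (any? (λ m → (proj₁ m ≟ₚ η) ×-dec (C ↭? redex-body m)) C)
  where
  redex-body : Elem → List Elem
  redex-body m = residual m ++ replicate (occ m C) m
  Witness : Elem → Set
  Witness m = proj₁ m ≡ η × C ↭ redex-body m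
  from : Any Witness C → Reducible η C
  from any with m , m∈C , m-η , C↭ ← find any with k , occ≡ ← occ-∈ m∈C =
    m , k , m-η , ≡.subst (λ j → C ↭ residual m ++ replicate j m) occ≡ C↭
  to : Reducible η C → Any Witness C
  to (m , k , m-η , C↭) =
    lose m∈C (m-η , ≡.subst (λ j → C ↭ residual m ++ replicate j m) (≡.sym occ≡) C↭)
    where
    m∈C : m ∈ C
    m∈C = ↭.∈-resp-↭ (↭-sym C↭) (∈-++⁺ʳ (residual m) (here refl))
    occ≡ : occ m C ≡ suc k
    occ≡ = ≡.trans (occ-↭ m C↭) (≡.trans (occ-residual-++ {e = m} _ ≤-refl) (occ-replicate m (suc k)))

prefix-nf : ∀ η C → Dec (Reducible η C) → List Elem
prefix-nf η C (yes (m , k , _)) = replicate (suc (suc k)) m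
prefix-nf η C (no _)            = (η , ∏ C) ∷ []

nf : Proc → List Elem
nf 𝟎       = []
nf (η ∙ P) = prefix-nf η (sort (nf P)) (reducible? η (sort (nf P)))
nf (P ∥ Q) = nf P ++ nf Q

prefix-nf-canonical : ∀ {η C} → Sorted C → All Canonical C → (d : Dec (Reducible η C)) →
                      All Canonical (prefix-nf η C d)
prefix-nf-canonical _  cC (yes (m , k , _ , C↭)) =
  All.replicate⁺ (suc (suc k)) (All.lookup cC (↭.∈-resp-↭ (↭-sym C↭) (∈-++⁺ʳ (residual m) (here refl))))
prefix-nf-canonical C↗ cC (no irr) = canonical C↗ cC irr ∷ []

nf-canonical : ∀ P → All Canonical (nf P)
nf-canonical 𝟎       = []
nf-canonical (η ∙ P) =
  prefix-nf-canonical (sort-↗ (nf P)) (↭.All-resp-↭ (↭-sym (sort-↭ (nf P))) (nf-canonical P))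
                      (reducible? η (sort (nf P)))
nf-canonical (P ∥ Q) = All.++⁺ (nf-canonical P) (nf-canonical Q)

⊢-prefix-nf : ∀ η C (d : Dec (Reducible η C)) → 𝒟⊢ pfx η ⌜ ∏ C ⌝ ≈ ⌜ ∏ (prefix-nf η C d) ⌝
⊢-prefix-nf η C (yes ((η , P) , k , refl , C↭)) = begin
  pfx η ⌜ ∏ C ⌝                                                 ≈⟨ cpfx η (⊢-↭ C↭) ⟩
  pfx η ⌜ ∏ (flat P ++ replicate (suc k) (η , P)) ⌝             ≈⟨ cpfx η (⊢-∏-++ (flat P) _) ⟩
  pfx η (par ⌜ ∏ (flat P) ⌝ ⌜ ∏ (replicate (suc k) (η , P)) ⌝)
    ≈⟨ cpfx η (cpar (⊢-flat P) (sym (⊢-replicate (suc k) _))) ⟨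
  pfx η (par ⌜ P ⌝ (pow (suc k) (pfx η ⌜ P ⌝)))                 ≈⟨ ⊢-D k η ⌜ P ⌝ ⟩
  pow (suc (suc k)) (pfx η ⌜ P ⌝)                               ≈⟨ ⊢-replicate (suc (suc k)) _ ⟨
  ⌜ ∏ (replicate (suc (suc k)) (η , P)) ⌝                       ∎
  where open 𝒟-Reasoning
⊢-prefix-nf η C (no _) = sym (⊢-identityʳ _)

⊢-nf : ∀ P → 𝒟⊢ ⌜ P ⌝ ≈ ⌜ ∏ (nf P) ⌝
⊢-nf 𝟎       = refl
⊢-nf (η ∙ P) =
  trans (cpfx η (trans (⊢-nf P) (⊢-↭ (↭-sym (sort-↭ (nf P)))))) (⊢-prefix-nf η _ (reducible? η _))
⊢-nf (P ∥ Q) = trans (cpar (⊢-nf P) (⊢-nf Q)) (sym (⊢-∏-++ (nf P) (nf Q)))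

-- Uniqueness of canonical products

∈⇒↭ : ∀ {x : Elem} {xs} → x ∈ xs → ∃[ R ] xs ↭ x ∷ R
∈⇒↭ x∈xs with ys , zs , refl ← ∈-∃++ x∈xs = ys ++ zs , ↭.shift _ ys zs

↭⇒∈ : ∀ {x : Elem} {xs R} → xs ↭ x ∷ R → x ∈ xs
↭⇒∈ xs↭ = ↭.∈-resp-↭ (↭-sym xs↭) (here refl)

↭-++-cancelˡ : ∀ (xs : List Elem) {ys zs} → xs ++ ys ↭ xs ++ zs → ys ↭ zs
↭-++-cancelˡ []       p = p
↭-++-cancelˡ (x ∷ xs) p = ↭-++-cancelˡ xs (↭.drop-∷ p)

All-≡⇒replicate : ∀ {m : Elem} xs → All (_≡ m) xs → xs ≡ replicate (length xs) m
All-≡⇒replicate []       []            = refl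
All-≡⇒replicate (x ∷ xs) (refl ∷ xs≡m) = cong (x ∷_) (All-≡⇒replicate xs xs≡m)

residual-swap⇒≡ : ∀ x y R → residual x ++ y ∷ R ↭ residual y ++ x ∷ R → x ≡ y
residual-swap⇒≡ x y R res with x ≟ₑ y
... | yes x≡y = x≡y
... | no  x≢y = contradiction occ≡ (m≢1+n+m (occ x R))
  where
  occ≡ : occ x R ≡ suc (occ x (residual y) + occ x R)
  occ≡ = begin
    occ x R                             ≡⟨ occ-there R x≢y ⟨
    occ x (y ∷ R)                       ≡⟨ occ-residual-++ {e = x} (y ∷ R) ≤-refl ⟨
    occ x (residual x ++ y ∷ R)         ≡⟨ occ-↭ x res ⟩
    occ x (residual y ++ x ∷ R)         ≡⟨ occ-++ x (residual y) (x ∷ R) ⟩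
    occ x (residual y) + occ x (x ∷ R)  ≡⟨ cong (occ x (residual y) +_) (occ-here x R) ⟩
    occ x (residual y) + suc (occ x R)  ≡⟨ +-suc _ _ ⟩
    suc (occ x (residual y) + occ x R)  ∎
    where open ≡.≡-Reasoning

∈-after-firing : ∀ {n e f R R'} → weight f ≤ weight n →
                 residual e ++ R ↭ residual f ++ R' → n ∈ R → n ∈ R'
∈-after-firing {e = e} {f} f≤n res n∈R
  with ∈-++⁻ (residual f) (↭.∈-resp-↭ res (∈-++⁺ʳ (residual e) n∈R))
... | inj₁ n∈res = contradiction n∈res (∉-residual {e = f} f≤n)
... | inj₂ n∈R'  = n∈R'

occ-after-firing : ∀ {n f R R'} → weight f ≤ weight n →
                   residual n ++ R ↭ residual f ++ R' → occ n R ≡ occ n R'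
occ-after-firing {n} {f} {R} {R'} f≤n res =
  ≡.trans (≡.sym (occ-residual-++ {e = n} R ≤-refl))
          (≡.trans (occ-↭ n res) (occ-residual-++ {e = f} R' f≤n))

Canonical-copies⇒≡ : ∀ {n m} k → Canonical n → Canonical m → proj₁ m ≡ proj₁ n →
                     residual n ↭ residual m ++ replicate k m → n ≡ m
Canonical-copies⇒≡ {n} {m} zero cn cm m-η res =
  Canonical-injective cn cm (≡.sym m-η) (≡.subst (residual n ↭_) (++-identityʳ _) res)
Canonical-copies⇒≡ {m = m} (suc k) cn cm m-η res = contradiction (m , k , m-η , res) (Canonical-irreducible cn)

Matches : List Elem → List Elem → Set
Matches N M = ∀ {n R} → N ↭ n ∷ R → Fires _↭_ M (proj₁ n) (residual n ++ R)

module Heaviest {N M : List Elem} (cN : All Canonical N) (cM : All Canonical M)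
                (N⇉M : Matches N M) (M⇉N : Matches M N) {n : Elem} (n∈N : n ∈ N)
                (N≤n : All (λ x → weight x ≤ weight n) N)
                (M≤n : All (λ x → weight x ≤ weight n) M) where

  N-lighter : ∀ {x R} → N ↭ x ∷ R → weight x ≤ weight n
  N-lighter N↭ = All.lookup N≤n (↭⇒∈ N↭)

  M-lighter : ∀ {x R} → M ↭ x ∷ R → weight x ≤ weight n
  M-lighter M↭ = All.lookup M≤n (↭⇒∈ M↭)

  -- Counting copies of n: firing n in N and matching it in M by some m ≢ n
  -- loses a copy of n on one side only; firing n in M cannot gain one back.
  matched-by-itself : n ∈ M → ∀ {R m R'} → N ↭ n ∷ R → M ↭ m ∷ R' →
                      residual n ++ R ↭ residual m ++ R' → m ≡ n
  matched-by-itself n∈M {R} {m} {R'} N↭ M↭ res with m ≟ₑ n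
  ... | yes m≡n = m≡n
  ... | no  m≢n with R₂ , M↭n ← ∈⇒↭ n∈M with M⇉N M↭n
  ... | fires n' R₃ N↭n' _ res' = contradiction occ< (<-irrefl refl)
    where
    open ≤-Reasoning
    occ< : occ n N < occ n N
    occ< = begin-strict
      occ n N           ≡⟨ occ-↭ n N↭n' ⟩
      occ n (n' ∷ R₃)   ≤⟨ occ-∷-≤ n n' R₃ ⟩
      suc (occ n R₃)    ≡⟨ cong suc (occ-after-firing {f = n'} (N-lighter N↭n') res') ⟨
      suc (occ n R₂)    ≡⟨ occ-here n R₂ ⟨
      occ n (n ∷ R₂)    ≡⟨ occ-↭ n M↭n ⟨
      occ n M           ≡⟨ occ-↭ n M↭ ⟩
      occ n (m ∷ R')    ≡⟨ occ-there R' (m≢n ∘ ≡.sym) ⟩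
      occ n R'          ≡⟨ occ-after-firing {f = m} (M-lighter M↭) res ⟨
      occ n R           <⟨ n<1+n _ ⟩
      suc (occ n R)     ≡⟨ occ-here n R ⟨
      occ n (n ∷ R)     ≡⟨ occ-↭ n N↭ ⟨
      occ n N           ∎

  ∉⇒singleton : n ∉ M → N ↭ n ∷ []
  ∉⇒singleton n∉M with ∈⇒↭ n∈N
  ... | []    , N↭ = N↭
  ... | x ∷ R , N↭ with N⇉M (↭-trans N↭ (↭.swap n x ↭.refl))
  ... | fires m R' M↭ _ res =
    contradiction (↭.∈-resp-↭ (↭-sym M↭) (there (∈-after-firing {e = x} {m} (M-lighter M↭) res (here refl))))
                  n∉M

  singleton⇒∈ : N ↭ n ∷ [] → n ∈ M
  singleton⇒∈ N↭ with fires m R' M↭ m-η res ← N⇉M N↭ = ≡.subst (_∈ M) (≡.sym n≡m) (↭⇒∈ M↭)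
    where
    copy : ∀ {x} → x ∈ R' → x ≡ m
    copy x∈R' with R₅ , R'↭ ← ∈⇒↭ x∈R'
                with fires n' R₆ N↭' _ res' ← M⇉N (↭-trans M↭ (↭-trans (↭.prep m R'↭) (↭.swap m _ ↭.refl)))
                with refl ← ↭.↭-singleton-inv (↭-trans (↭-sym N↭') N↭) =
      residual-swap⇒≡ _ m R₅ (↭-trans res' (↭-trans res (↭.++⁺ˡ (residual m) R'↭)))
    n≡m : n ≡ m
    n≡m = Canonical-copies⇒≡ (length R') (All.lookup cN n∈N) (All.lookup cM (↭⇒∈ M↭)) m-η
            (≡.subst₂ _↭_ (++-identityʳ _)
                          (cong (residual m ++_) (All-≡⇒replicate R' (All.tabulate copy))) res)

  n∈M : n ∈ M
  n∈M with n ∈? M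
  ... | yes n∈M = n∈M
  ... | no  n∉M = contradiction (singleton⇒∈ (∉⇒singleton n∉M)) n∉M

  unique : N ↭ M
  unique with R , N↭ ← ∈⇒↭ n∈N with N⇉M N↭
  ... | fires m R' M↭ _ res with refl ← matched-by-itself n∈M N↭ M↭ res =
    ↭-trans N↭ (↭-trans (↭.prep n (↭-++-cancelˡ (residual n) res)) (↭-sym M↭))

heaviest : Elem → List Elem → Elem
heaviest = argmax weight

heaviest-∈ : ∀ x xs → heaviest x xs ∈ x ∷ xs
heaviest-∈ x xs with argmax-sel weight x xs
... | inj₁ heaviest≡x = here heaviest≡x
... | inj₂ heaviest∈xs = there heaviest∈xs

heaviest-≥ : ∀ x xs → All (λ y → weight y ≤ weight (heaviest x xs)) (x ∷ xs)
heaviest-≥ x xs = f[⊥]≤f[argmax] {f = weight} x xs ∷ f[xs]≤f[argmax] {f = weight} x xs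

matching-unique : ∀ {N M} → All Canonical N → All Canonical M → Matches N M → Matches M N → N ↭ M
matching-unique {[]}    {[]}    _  _  _   _    = ↭.refl
matching-unique {[]}    {_ ∷ _} _  _  _   M⇉[] with fires _ _ []↭ _ _ ← M⇉[] ↭.refl =
  contradiction (↭-sym []↭) ↭.¬x∷xs↭[]
matching-unique {x ∷ N} {M}     cN cM N⇉M M⇉N
  with N≤n , M≤n ← All.++⁻ (x ∷ N) (heaviest-≥ x (N ++ M))
  with ∈-++⁻ (x ∷ N) (heaviest-∈ x (N ++ M))
... | inj₁ n∈N = Heaviest.unique cN cM N⇉M M⇉N n∈N N≤n M≤n
... | inj₂ n∈M = ↭-sym (Heaviest.unique cM cN M⇉N N⇉M n∈M M≤n N≤n)

‖‖-fire-≤ : ∀ {N e R k} → N ↭ e ∷ R → ‖ N ‖ ≤ suc k → ‖ residual e ++ R ‖ ≤ k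
‖‖-fire-≤ {k = k} N↭ N≤ = ≤-pred (≡.subst (_≤ suc k) (‖‖-fire N↭) N≤)

fire-canonical : ∀ {N e R} → All Canonical N → N ↭ e ∷ R → All Canonical (residual e ++ R)
fire-canonical cN N↭ with ce ∷ cR ← ↭.All-resp-↭ N↭ cN = All.++⁺ (Canonical-residual ce) cR

canonical-unique : ∀ k {N M} → ‖ N ‖ ≤ k → ‖ M ‖ ≤ k →
                   All Canonical N → All Canonical M → ∏ N ≃ ∏ M → N ↭ M
canonical-unique zero    {[]}          {[]}          _  _  _  _  _   = ↭.refl
canonical-unique zero    {(_ , _) ∷ _} {_}           () _  _  _  _
canonical-unique zero    {[]}          {(_ , _) ∷ _} _  () _  _  _
canonical-unique (suc k) N≤ M≤ cN cM N≃M =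
  matching-unique cN cM (matches N≤ M≤ cN cM N≃M) (matches M≤ N≤ cM cN (≃-sym N≃M))
  where
  matches : ∀ {N M} → ‖ N ‖ ≤ suc k → ‖ M ‖ ≤ suc k →
            All Canonical N → All Canonical M → ∏ N ≃ ∏ M → Matches N M
  matches N≤ M≤ cN cM N≃M N↭ with fires m R' M↭ m-η res ← ∏-match N≃M N↭ =
    fires m R' M↭ m-η
      (canonical-unique k (‖‖-fire-≤ N↭ N≤) (‖‖-fire-≤ M↭ M≤)
                          (fire-canonical cN N↭) (fire-canonical cM M↭) res)

bisimilar-canonical-↭ : ∀ {N M} → All Canonical N → All Canonical M → ∏ N ≃ ∏ M → N ↭ M
bisimilar-canonical-↭ {N} {M} = canonical-unique (‖ N ‖ ⊔ ‖ M ‖) (m≤m⊔n _ _) (m≤n⊔m _ _)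

nf-≃ : ∀ P → P ≃ ∏ (nf P)
nf-≃ P = sound-closed (⊢-nf P)

≃⇒nf-↭ : ∀ {P Q} → P ≃ Q → nf P ↭ nf Q
≃⇒nf-↭ {P} {Q} P≃Q = bisimilar-canonical-↭ (nf-canonical P) (nf-canonical Q)
                       (≃-trans (≃-sym (nf-≃ P)) (≃-trans P≃Q (nf-≃ Q)))

proposition3p2 : (P Q : Proc) → (P ∼ Q) ⇔ (𝒟⊢ ⌜ P ⌝ ≈ ⌜ Q ⌝)
proposition3p2 P Q = mk⇔ complete (≃⇒∼ ∘ sound-closed)
  where
  complete : P ∼ Q → 𝒟⊢ ⌜ P ⌝ ≈ ⌜ Q ⌝
  complete P∼Q = begin
    ⌜ P ⌝         ≈⟨ ⊢-nf P ⟩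
    ⌜ ∏ (nf P) ⌝  ≈⟨ ⊢-↭ (≃⇒nf-↭ (∼⇒≃ P∼Q)) ⟩
    ⌜ ∏ (nf Q) ⌝  ≈⟨ ⊢-nf Q ⟨
    ⌜ Q ⌝         ∎
    where open 𝒟-Reasoning
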